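{- Let $D$ be an arc-colored strongly connected tournament on $n$ vertices. If $c(D)\geq \frac{n(n-1)}{2}-n+3$, then $D$ contains a rainbow triangle.
   Context: A tournament is obtained from $K_n$ by replacing each edge $xy$ with exactly one of the arcs $xy$, $yx$. A digraph is strongly connected if for every ordered pair of distinct vertices $x,y$ there is a directed $(x,y)$-path. An arc-coloring of $D$ is a map $C:A(D)\to\mathbb{N}$; $c(D)$ is the number of distinct colors used. A rainbow triangle is a directed cycle of length $3$ whose arcs have pairwise distinct colors. -}

module Defs where

open import Data.Bool using (Bool; true; false; T)
open import Data.Nat using (ℕ)
open import Data.Nat.Properties using (_≟_)
open import Data.Fin using (Fin)
open import Data.List using (List; []; _∷_; length; map; filter; deduplicate; allFin; cartesianProduct; head; last)
open import Data.List.Relation.Unary.Unique.Propositional using (Unique)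
open import Data.Maybe using (just)
open import Data.Product using (_×_; _,_; proj₁; proj₂; ∃-syntax)
open import Data.Sum using (_⊎_)
open import Relation.Binary.PropositionalEquality using (_≡_; _≢_)
open import Relation.Nullary using (¬_)
open import Relation.Nullary.Decidable using (does)

Digraph : ℕ → Set
Digraph n = Fin n → Fin n → Bool

Arc : ∀ {n} → Digraph n → Fin n → Fin n → Set
Arc D x y = T (D x y)

IsTournament : ∀ {n} → Digraph n → Set
IsTournament {n} D =
  (∀ x → ¬ Arc D x x) ×
  (∀ x y → x ≢ y → (Arc D x y ⊎ Arc D y x) × ¬ (Arc D x y × Arc D y x))

data Walk {n} (D : Digraph n) : List (Fin n) → Set where
  single : ∀ x → Walk D (x ∷ [])
  step   : ∀ x y vs → Arc D x y → Walk D (y ∷ vs) → Walk D (x ∷ y ∷ vs)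

Path : ∀ {n} → Digraph n → Fin n → Fin n → Set
Path {n} D x y =
  ∃[ vs ] (Walk D vs × Unique vs × head vs ≡ just x × last vs ≡ just y)

StronglyConnected : ∀ {n} → Digraph n → Set
StronglyConnected {n} D = ∀ (x y : Fin n) → x ≢ y → Path D x y

-- An arc-colouring: colours assigned to ordered pairs; only values on arcs matter.
ArcColoring : ℕ → Set
ArcColoring n = Fin n → Fin n → ℕ

arcs : ∀ {n} → Digraph n → List (Fin n × Fin n)
arcs {n} D = filter (λ p → Data.Bool.Properties.T? (D (proj₁ p) (proj₂ p)))
                    (cartesianProduct (allFin n) (allFin n))
  where import Data.Bool.Properties

numColors : ∀ {n} → Digraph n → ArcColoring n → ℕ
numColors D C = length (deduplicate _≟_ (map (λ p → C (proj₁ p) (proj₂ p)) (arcs D)))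

RainbowTriangle : ∀ {n} → Digraph n → ArcColoring n → Set
RainbowTriangle {n} D C =
  ∃[ x ] ∃[ y ] ∃[ z ]
    (Arc D x y × Arc D y z × Arc D z x ×
     C x y ≢ C y z × C y z ≢ C z x × C x y ≢ C z x)

module Submission where

-- Suppose D has no rainbow triangle. Grow a vertex set S, starting from a directed triangle, such
-- that D[S] has a Hamiltonian cycle and its arcs carry at most C(|S|,2) − |S| + 2 colours. A vertex v
-- outside S with both an in- and an out-neighbour in S can be inserted into the cycle, and it lies on
-- a directed triangle v → p → q → v with p, q ∈ S; as that triangle is not rainbow, one of the |S|
-- arcs between v and S repeats a colour already present. If instead every outside vertex dominates
-- or is dominated by S, strong connectivity produces such a vertex or an arc b → a with S ⇒ b and
-- a ⇒ S; the cycle is rerouted through b and a, and the non-rainbow triangles a → s → b → a for two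
-- vertices s of S save two of the 2|S| + 1 new colours. When S = V we get c(D) ≤ C(n,2) − n + 2.

open import Defs
open import Data.Bool.Properties using (T?)
open import Data.Empty using (⊥-elim)
open import Data.Fin using (Fin; zero; suc)
import Data.Fin.Properties as Fin
open import Data.Maybe using (just)
open import Data.List
  using (List; []; _∷_; head; last; _++_; [_]; _∷ʳ_; length; map; allFin; cartesianProduct; deduplicate)
open import Data.List.Properties
  using (length-++; length-map; length-filter; length-deduplicate; length-tabulate)
open import Data.List.Membership.Propositional using (_∈_; _∉_; lose)
open import Data.List.Membership.Propositional.Properties
  using (∈-∃++; ∈-++⁺ˡ; ∈-++⁺ʳ; ∈-map⁺; ∈-map⁻; ∈-allFin; ∈-deduplicate⁻; ∈-filter⁻)
open import Data.List.Relation.Binary.Subset.Propositional using (_⊆_)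
open import Data.List.Relation.Binary.Permutation.Propositional
  using (_↭_; ↭-refl; ↭-sym; ↭-trans; prep; swap; ↭⇒↭ₛ)
open import Data.List.Relation.Binary.Permutation.Propositional.Properties
  using (∈-resp-↭; ↭-length; shift; ∷↭∷ʳ)
import Data.List.Relation.Binary.Permutation.Setoid.Properties as ↭ₛ
open import Data.List.Relation.Unary.All as All using (All; []; _∷_; all?)
open import Data.List.Relation.Unary.All.Properties using (¬Any⇒All¬)
open import Data.List.Relation.Unary.Any as Any using (Any; here; there; any?)
open import Data.List.Relation.Unary.AllPairs using ([]; _∷_)
open import Data.List.Relation.Unary.Unique.Propositional using (Unique)
open import Data.List.Relation.Unary.Unique.Propositional.Properties using (allFin⁺)
open import Data.List.Relation.Unary.Unique.DecPropositional.Properties using (deduplicate-!)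
open import Data.Nat using (ℕ; zero; suc; _+_; _*_; _≤_; _<_; z≤n; s≤s)
open import Data.Nat.Combinatorics using (_C_; nC1≡n; nCk+nC[k+1]≡[n+1]C[k+1])
open import Data.Nat.Properties
  using (_≟_; ≤-refl; ≤-reflexive; ≤-trans; ≤-antisym; +-mono-≤; +-monoˡ-≤; +-cancelˡ-≤; m≤n+m;
         +-identityʳ; +-comm; +-suc; n≮n; module ≤-Reasoning)
open import Data.Nat.Tactic.RingSolver using (solve-∀)
open import Data.Product using (_×_; _,_; proj₁; proj₂; Σ; ∃; ∃₂)
open import Data.Sum using (_⊎_; inj₁; inj₂; [_,_]′)
open import Function using (_∘_)
open import Relation.Binary.PropositionalEquality
  using (_≡_; _≢_; refl; sym; trans; cong; cong₂; subst; subst₂; setoid; module ≡-Reasoning)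
open import Relation.Nullary using (¬_; Dec; yes; no)
open import Relation.Nullary.Decidable using (¬?; _×-dec_; decidable-stable)
open import Relation.Unary using (Decidable)

module _ {A : Set} where

  Unique-resp-↭ : {xs ys : List A} → xs ↭ ys → Unique xs → Unique ys
  Unique-resp-↭ xs↭ys = ↭ₛ.Unique-resp-↭ (setoid A) (↭⇒↭ₛ xs↭ys)

  ∉⇒≢ : ∀ {v s : A} {L} → v ∉ L → s ∈ L → v ≢ s
  ∉⇒≢ v∉L s∈L refl = v∉L s∈L

  ∈-insert⁻ : ∀ {z r : A} xs ys → z ∈ xs ++ [ r ] ++ ys → z ≡ r ⊎ z ∈ xs ++ ys
  ∈-insert⁻ xs ys z∈ with ∈-resp-↭ (shift _ xs ys) z∈
  ... | here z≡r = inj₁ z≡r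
  ... | there z∈′ = inj₂ z∈′

  Unique⇒length-mono-⊆ : {xs ys : List A} → Unique xs → xs ⊆ ys → length xs ≤ length ys
  Unique⇒length-mono-⊆ {[]} _ _ = z≤n
  Unique⇒length-mono-⊆ {x ∷ xs} (x∉xs ∷ unique) xs⊆ys with us , vs , refl ← ∈-∃++ (xs⊆ys (here refl)) =
    ≤-trans (s≤s (Unique⇒length-mono-⊆ unique xs⊆us++vs)) (≤-reflexive (sym (↭-length (shift x us vs))))
    where
    xs⊆us++vs : xs ⊆ us ++ vs
    xs⊆us++vs z∈xs with ∈-insert⁻ us vs (xs⊆ys (there z∈xs))
    ... | inj₁ z≡x = ⊥-elim (All.lookup x∉xs z∈xs (sym z≡x))
    ... | inj₂ z∈us++vs = z∈us++vs

length-allFin : ∀ n → length (allFin n) ≡ n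
length-allFin n = length-tabulate (λ i → i)

Unique⇒length≤ : ∀ {n} {xs : List (Fin n)} → Unique xs → length xs ≤ n
Unique⇒length≤ {n} {xs} unique =
  subst (length xs ≤_) (length-allFin n) (Unique⇒length-mono-⊆ unique (λ {z} _ → ∈-allFin z))

Unique∧spanning⇒length≡ : ∀ {n} {xs : List (Fin n)} → Unique xs → (∀ z → z ∈ xs) → length xs ≡ n
Unique∧spanning⇒length≡ {n} {xs} unique spanning = ≤-antisym (Unique⇒length≤ unique)
  (subst (_≤ length xs) (length-allFin n) (Unique⇒length-mono-⊆ (allFin⁺ n) (λ {z} _ → spanning z)))

[1+n]C2 : ∀ n → suc n C 2 ≡ n + n C 2
[1+n]C2 n = trans (sym (nCk+nC[k+1]≡[n+1]C[k+1] n 1)) (cong (_+ n C 2) (nC1≡n n))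

[m+n]C2 : ∀ m n → (m + n) C 2 ≡ m C 2 + m * n + n C 2
[m+n]C2 zero n = refl
[m+n]C2 (suc m) n = begin
  suc (m + n) C 2                    ≡⟨ [1+n]C2 (m + n) ⟩
  m + n + (m + n) C 2                ≡⟨ cong (m + n +_) ([m+n]C2 m n) ⟩
  m + n + (m C 2 + m * n + n C 2)    ≡⟨ regroup m n (m C 2) (m * n) (n C 2) ⟩
  (m + m C 2) + (n + m * n) + n C 2  ≡⟨ cong (λ c → c + suc m * n + n C 2) ([1+n]C2 m) ⟨
  suc m C 2 + suc m * n + n C 2      ∎
  where
  open ≡-Reasoning
  regroup : ∀ m n a b c → m + n + (a + b + c) ≡ (m + a) + (n + b) + c
  regroup = solve-∀

-- t colours on k vertices stay within the paper's bound C(k,2) − k + 2 (written without ∸).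
InBudget : ℕ → ℕ → Set
InBudget t k = t + k ≤ k C 2 + 2

InBudget-extend : ∀ {t e j k} → InBudget t k → e + j ≤ j * k + j C 2 → InBudget (t + e) (j + k)
InBudget-extend {t} {e} {j} {k} old new = begin
  t + e + (j + k)                ≡⟨ regroup t e j k ⟩
  (t + k) + (e + j)              ≤⟨ +-mono-≤ old new ⟩
  (k C 2 + 2) + (j * k + j C 2)  ≡⟨ regroup′ (k C 2) (j * k) (j C 2) ⟩
  (j C 2 + j * k + k C 2) + 2    ≡⟨ cong (_+ 2) ([m+n]C2 j k) ⟨
  (j + k) C 2 + 2                ∎
  where
  open ≤-Reasoning
  regroup : ∀ t e j k → t + e + (j + k) ≡ (t + k) + (e + j)
  regroup = solve-∀
  regroup′ : ∀ a b c → (a + 2) + (b + c) ≡ (c + b + a) + 2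
  regroup′ = solve-∀

over-budget : ∀ {c k} → k C 2 + 3 ≤ c + k → ¬ InBudget c k
over-budget {k = k} enough within with +-cancelˡ-≤ (k C 2) 3 2 (≤-trans enough within)
... | s≤s (s≤s ())

module Tournament {n : ℕ} (D : Digraph n) (tournament : IsTournament D) where

  open import Data.List.Membership.DecPropositional (Fin._≟_ {n}) using (_∈?_)

  infix 4 _⇒_
  _⇒_ : Fin n → Fin n → Set
  x ⇒ y = Arc D x y

  _⇒?_ : ∀ x y → Dec (x ⇒ y)
  x ⇒? y = T? (D x y)

  ⇒-irrefl : ∀ {x} → ¬ x ⇒ x
  ⇒-irrefl = proj₁ tournament _

  ⇒-≢ : ∀ {x y} → x ⇒ y → x ≢ y
  ⇒-≢ x⇒x refl = ⇒-irrefl x⇒x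

  ⇒-asym : ∀ {x y} → x ⇒ y → ¬ y ⇒ x
  ⇒-asym x⇒y y⇒x = proj₂ (proj₂ tournament _ _ (⇒-≢ x⇒y)) (x⇒y , y⇒x)

  flip-¬⇒ : ∀ {x y} → x ≢ y → ¬ x ⇒ y → y ⇒ x
  flip-¬⇒ x≢y ¬x⇒y with proj₁ (proj₂ tournament _ _ x≢y)
  ... | inj₁ x⇒y = ⊥-elim (¬x⇒y x⇒y)
  ... | inj₂ y⇒x = y⇒x

  infixr 5 _◅_
  data Chain : Fin n → Fin n → List (Fin n) → Set where
    done : ∀ x → Chain x x [ x ]
    _◅_  : ∀ {x y z L} → x ⇒ y → Chain y z L → Chain x z (x ∷ L)

  walk⇒chain : ∀ {L x y} → Walk D L → head L ≡ just x → last L ≡ just y → Chain x y L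
  walk⇒chain (single x) refl refl = done x
  walk⇒chain (step x y L x⇒y walk) refl last≡y = x⇒y ◅ walk⇒chain walk refl last≡y

  head∈ : ∀ {x y L} → Chain x y L → x ∈ L
  head∈ (done x) = here refl
  head∈ (_ ◅ _) = here refl

  last∈ : ∀ {x y L} → Chain x y L → y ∈ L
  last∈ (done x) = here refl
  last∈ (_ ◅ chain) = there (last∈ chain)

  infixl 5 _▻_
  _▻_ : ∀ {x y z L} → Chain x y L → y ⇒ z → Chain x z (L ∷ʳ z)
  done x ▻ x⇒z = x⇒z ◅ done _
  (x⇒y ◅ chain) ▻ y⇒z = x⇒y ◅ (chain ▻ y⇒z)

  Crossing : (Fin n → Set) → List (Fin n) → Set
  Crossing Q L = ∃₂ λ p q → p ∈ L × q ∈ L × p ⇒ q × Q p × ¬ Q q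

  Crossing-∷ : ∀ {Q L x} → Crossing Q L → Crossing Q (x ∷ L)
  Crossing-∷ (p , q , p∈ , q∈ , rest) = p , q , there p∈ , there q∈ , rest

  crossing-to-last : ∀ {Q x y L} → Decidable Q → Chain x y L → Any Q L → ¬ Q y → Crossing Q L
  crossing-to-last Q? (done x) (here Qx) ¬Qy = ⊥-elim (¬Qy Qx)
  crossing-to-last Q? (_◅_ {y = y} x⇒y chain) (here Qx) ¬Qz with Q? y
  ... | no ¬Qy = _ , y , here refl , there (head∈ chain) , x⇒y , Qx , ¬Qy
  ... | yes Qy = Crossing-∷ (crossing-to-last Q? chain (lose (head∈ chain) Qy) ¬Qz)
  crossing-to-last Q? (_ ◅ chain) (there anyQ) ¬Qz = Crossing-∷ (crossing-to-last Q? chain anyQ ¬Qz)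

  crossing-from-head : ∀ {Q x y L} → Decidable Q → Chain x y L → Q x → Any (¬_ ∘ Q) L →
                       Crossing Q L
  crossing-from-head Q? (done x) Qx (here ¬Qx) = ⊥-elim (¬Qx Qx)
  crossing-from-head Q? (_ ◅ _) Qx (here ¬Qx) = ⊥-elim (¬Qx Qx)
  crossing-from-head Q? (_◅_ {y = y} x⇒y chain) Qx (there any¬Q) with Q? y
  ... | no ¬Qy = _ , y , here refl , there (head∈ chain) , x⇒y , Qx , ¬Qy
  ... | yes Qy = Crossing-∷ (crossing-from-head Q? chain Qy any¬Q)

  Insertion : Fin n → Fin n → Fin n → List (Fin n) → Set
  Insertion v x y L = ∃ λ L′ → Chain x y L′ × L′ ↭ v ∷ L

  Insertion-◅ : ∀ {v x y z L} → x ⇒ y → Insertion v y z L → Insertion v x z (x ∷ L)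
  Insertion-◅ x⇒y (L′ , chain′ , L′↭) = _ , x⇒y ◅ chain′ , ↭-trans (prep _ L′↭) (swap _ _ ↭-refl)

  insert-head⇒ : ∀ {v x y L} → Chain x y L → x ⇒ v → Any (v ⇒_) L → v ∉ L → Insertion v x y L
  insert-head⇒ (done x) x⇒v (here v⇒x) v∉ = ⊥-elim (⇒-asym x⇒v v⇒x)
  insert-head⇒ {v} (_◅_ {y = y} x⇒y chain) x⇒v anyOut v∉ with v ⇒? y | anyOut
  ... | yes v⇒y | _ = _ , x⇒v ◅ v⇒y ◅ chain , swap _ _ ↭-refl
  ... | no _ | here v⇒x = ⊥-elim (⇒-asym x⇒v v⇒x)
  ... | no ¬v⇒y | there anyOut′ = Insertion-◅ x⇒y
    (insert-head⇒ chain (flip-¬⇒ (∉⇒≢ v∉ (there (head∈ chain))) ¬v⇒y) anyOut′ (v∉ ∘ there))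

  insert-⇒last : ∀ {v x y L} → Chain x y L → v ⇒ y → Any (_⇒ v) L → v ∉ L → Insertion v x y L
  insert-⇒last {v} {x} chain v⇒y anyIn v∉ with x ⇒? v
  ... | yes x⇒v = insert-head⇒ chain x⇒v (lose (last∈ chain) v⇒y) v∉
  insert-⇒last (done x) v⇒x (here x⇒v) v∉ | no ¬x⇒v = ⊥-elim (¬x⇒v x⇒v)
  insert-⇒last (_ ◅ _) v⇒y (here x⇒v) v∉ | no ¬x⇒v = ⊥-elim (¬x⇒v x⇒v)
  insert-⇒last (x⇒y ◅ chain) v⇒y (there anyIn) v∉ | no _ =
    Insertion-◅ x⇒y (insert-⇒last chain v⇒y anyIn (v∉ ∘ there))

  record Cycle (L : List (Fin n)) : Set where
    constructor cycle
    field
      {first final} : Fin n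
      chain : Chain first final L
      closing : final ⇒ first

  Cycle-length : ∀ {L} → Cycle L → 2 ≤ length L
  Cycle-length (cycle (done x) x⇒x) = ⊥-elim (⇒-irrefl x⇒x)
  Cycle-length (cycle (_ ◅ done _) _) = s≤s (s≤s z≤n)
  Cycle-length (cycle (_ ◅ _ ◅ _) _) = s≤s (s≤s z≤n)

  insert-cycle : ∀ {v L} → Cycle L → Any (_⇒ v) L → Any (v ⇒_) L → v ∉ L →
                 ∃ λ L′ → Cycle L′ × L′ ↭ v ∷ L
  insert-cycle {v} {L} (cycle {h} {l} chain l⇒h) anyIn anyOut v∉ with h ⇒? v | l ⇒? v
  ... | yes h⇒v | _ with L′ , chain′ , L′↭ ← insert-head⇒ chain h⇒v anyOut v∉ =
    L′ , cycle chain′ l⇒h , L′↭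
  ... | no ¬h⇒v | yes l⇒v =
    L ∷ʳ v , cycle (chain ▻ l⇒v) (flip-¬⇒ (∉⇒≢ v∉ (head∈ chain) ∘ sym) ¬h⇒v) , ↭-sym (∷↭∷ʳ v L)
  ... | no _ | no ¬l⇒v
    with L′ , chain′ , L′↭ ← insert-⇒last chain (flip-¬⇒ (∉⇒≢ v∉ (last∈ chain) ∘ sym) ¬l⇒v) anyIn v∉ =
    L′ , cycle chain′ l⇒h , L′↭

  DirectedTriangleThrough : Fin n → List (Fin n) → Set
  DirectedTriangleThrough v L = ∃₂ λ p q → p ∈ L × q ∈ L × v ⇒ p × p ⇒ q × q ⇒ v

  crossing⇒triangle : ∀ {v L} → v ∉ L → Crossing (v ⇒_) L → DirectedTriangleThrough v L
  crossing⇒triangle v∉ (p , q , p∈ , q∈ , p⇒q , v⇒p , ¬v⇒q) =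
    p , q , p∈ , q∈ , v⇒p , p⇒q , flip-¬⇒ (∉⇒≢ v∉ q∈) ¬v⇒q

  triangle-through : ∀ {v L} → Cycle L → Any (_⇒ v) L → Any (v ⇒_) L → v ∉ L →
                     DirectedTriangleThrough v L
  triangle-through {v} (cycle {h} {l} chain l⇒h) anyIn anyOut v∉ with v ⇒? h | v ⇒? l
  ... | yes v⇒h | _ = crossing⇒triangle v∉
    (crossing-from-head (v ⇒?_) chain v⇒h (Any.map (λ q⇒v v⇒q → ⇒-asym v⇒q q⇒v) anyIn))
  ... | no ¬v⇒h | yes v⇒l =
    l , h , last∈ chain , head∈ chain , v⇒l , l⇒h , flip-¬⇒ (∉⇒≢ v∉ (head∈ chain)) ¬v⇒h
  ... | no _ | no ¬v⇒l = crossing⇒triangle v∉ (crossing-to-last (v ⇒?_) chain anyOut ¬v⇒l)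

  data Position (S : List (Fin n)) (v : Fin n) : Set where
    mixed     : Any (_⇒ v) S → Any (v ⇒_) S → Position S v
    dominates : All (v ⇒_) S → Position S v
    dominated : All (_⇒ v) S → Position S v

  position : ∀ S {v} → v ∉ S → Position S v
  position S {v} v∉ with any? (_⇒? v) S | any? (v ⇒?_) S
  ... | yes anyIn | yes anyOut = mixed anyIn anyOut
  ... | no ¬anyIn | _ =
    dominates (All.tabulate λ s∈ → flip-¬⇒ (∉⇒≢ v∉ s∈ ∘ sym) (¬anyIn ∘ lose s∈))
  ... | yes _ | no ¬anyOut =
    dominated (All.tabulate λ s∈ → flip-¬⇒ (∉⇒≢ v∉ s∈) (¬anyOut ∘ lose s∈))

  dominated-∉ : ∀ {S p} → All (_⇒ p) S → p ∉ S
  dominated-∉ S⇒p p∈ = ⇒-irrefl (All.lookup S⇒p p∈)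

  dominating-∉ : ∀ {S p} → All (p ⇒_) S → p ∉ S
  dominating-∉ p⇒S p∈ = ⇒-irrefl (All.lookup p⇒S p∈)

  out-of-dominated-∉ : ∀ {S p q} → All (_⇒ p) S → p ⇒ q → q ∉ S
  out-of-dominated-∉ S⇒p p⇒q q∈ = ⇒-asym p⇒q (All.lookup S⇒p q∈)

  into-dominating-∉ : ∀ {S p q} → All (q ⇒_) S → p ⇒ q → p ∉ S
  into-dominating-∉ q⇒S p⇒q p∈ = ⇒-asym p⇒q (All.lookup q⇒S p∈)

  module _ (strong : StronglyConnected D) where

    chain-between : ∀ {x y} → x ≢ y → ∃ (Chain x y)
    chain-between x≢y with L , walk , _ , head≡ , last≡ ← strong _ _ x≢y =
      L , walk⇒chain walk head≡ last≡

    directed-triangle : ∀ {x y} → x ⇒ y → ∃₂ λ p q → x ⇒ p × p ⇒ q × q ⇒ x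
    directed-triangle {x} x⇒y
      with _ , chain ← chain-between (⇒-≢ x⇒y ∘ sym)
      with p , q , _ , _ , p⇒q , x⇒p , ¬x⇒q ←
             crossing-to-last (x ⇒?_) chain (lose (head∈ chain) x⇒y) ⇒-irrefl
      = p , q , x⇒p , p⇒q , flip-¬⇒ (λ { refl → ⇒-asym x⇒p p⇒q }) ¬x⇒q

  module Colouring (col : ArcColoring n) (rainbow-free : ¬ RainbowTriangle D col) where

    non-rainbow : ∀ {x y z} → x ⇒ y → y ⇒ z → z ⇒ x →
                  col x y ≡ col y z ⊎ col y z ≡ col z x ⊎ col x y ≡ col z x
    non-rainbow {x} {y} {z} x⇒y y⇒z z⇒x
      with col x y ≟ col y z | col y z ≟ col z x | col x y ≟ col z x
    ... | yes xy≡yz | _ | _ = inj₁ xy≡yz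
    ... | no _ | yes yz≡zx | _ = inj₂ (inj₁ yz≡zx)
    ... | no _ | no _ | yes xy≡zx = inj₂ (inj₂ xy≡zx)
    ... | no xy≢yz | no yz≢zx | no xy≢zx =
      ⊥-elim (rainbow-free (x , y , z , x⇒y , y⇒z , z⇒x , xy≢yz , yz≢zx , xy≢zx))

    edgeColour : Fin n → Fin n → ℕ
    edgeColour v s with v ⇒? s
    ... | yes _ = col v s
    ... | no _ = col s v

    edgeColour-out : ∀ {v s} → v ⇒ s → edgeColour v s ≡ col v s
    edgeColour-out {v} {s} v⇒s with v ⇒? s
    ... | yes _ = refl
    ... | no ¬v⇒s = ⊥-elim (¬v⇒s v⇒s)

    edgeColour-in : ∀ {v s} → s ⇒ v → edgeColour v s ≡ col s v
    edgeColour-in {v} {s} s⇒v with v ⇒? s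
    ... | yes v⇒s = ⊥-elim (⇒-asym s⇒v v⇒s)
    ... | no _ = refl

    Covers : List (Fin n) → List ℕ → Set
    Covers S T = ∀ {x y} → x ∈ S → y ∈ S → x ⇒ y → col x y ∈ T

    Covers-singleton : ∀ {x T} → Covers [ x ] T
    Covers-singleton (here refl) (here refl) x⇒x = ⊥-elim (⇒-irrefl x⇒x)

    Covers-∷ : ∀ {S T v} → Covers S T → (∀ {s} → s ∈ S → edgeColour v s ∈ T) → Covers (v ∷ S) T
    Covers-∷ _ _ (here refl) (here refl) v⇒v = ⊥-elim (⇒-irrefl v⇒v)
    Covers-∷ _ new (here refl) (there y∈) v⇒y = subst (_∈ _) (edgeColour-out v⇒y) (new y∈)
    Covers-∷ _ new (there x∈) (here refl) x⇒v = subst (_∈ _) (edgeColour-in x⇒v) (new x∈)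
    Covers-∷ covers _ (there x∈) (there y∈) x⇒y = covers x∈ y∈ x⇒y

    Covers-resp-↭ : ∀ {S S′ T} → S ↭ S′ → Covers S T → Covers S′ T
    Covers-resp-↭ S↭S′ covers x∈ y∈ =
      covers (∈-resp-↭ (↭-sym S↭S′) x∈) (∈-resp-↭ (↭-sym S↭S′) y∈)

    Covers-mono : ∀ {S T T′} → T ⊆ T′ → Covers S T → Covers S T′
    Covers-mono T⊆T′ covers x∈ y∈ x⇒y = T⊆T′ (covers x∈ y∈ x⇒y)

    -- Adding N to S adds |N||S| + C(|N|,2) arcs; E must colour them with |N| colours to spare.
    ColourExtension : List ℕ → List (Fin n) → List (Fin n) → Set
    ColourExtension T S N =
      ∃ λ E → Covers (N ++ S) (T ++ E) × length E + length N ≤ length N * length S + length N C 2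

    one-vertex-extension : ∀ {S T v} r → Covers S T → r ∈ S →
      (∀ xs ys → S ≡ xs ++ [ r ] ++ ys → edgeColour v r ∈ T ++ map (edgeColour v) (xs ++ ys)) →
      ColourExtension T S [ v ]
    one-vertex-extension {T = T} {v} r covers r∈ redundant with xs , ys , refl ← ∈-∃++ r∈ =
      map (edgeColour v) (xs ++ ys) , Covers-∷ (Covers-mono ∈-++⁺ˡ covers) new , ≤-reflexive count
      where
      new : ∀ {s} → s ∈ xs ++ [ r ] ++ ys → edgeColour v s ∈ T ++ map (edgeColour v) (xs ++ ys)
      new s∈ with ∈-insert⁻ xs ys s∈
      ... | inj₁ refl = redundant xs ys refl
      ... | inj₂ s∈′ = ∈-++⁺ʳ T (∈-map⁺ (edgeColour v) s∈′)
      count : length (map (edgeColour v) (xs ++ ys)) + 1 ≡ 1 * length (xs ++ [ r ] ++ ys) + 1 C 2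
      count = begin
        length (map (edgeColour v) (xs ++ ys)) + 1  ≡⟨ cong (_+ 1) (length-map _ (xs ++ ys)) ⟩
        length (xs ++ ys) + 1                       ≡⟨ +-comm _ 1 ⟩
        suc (length (xs ++ ys))                     ≡⟨ ↭-length (shift r xs ys) ⟨
        length (xs ++ [ r ] ++ ys)                  ≡⟨ +-identityʳ _ ⟨
        length (xs ++ [ r ] ++ ys) + 0              ≡⟨ +-identityʳ _ ⟨
        1 * length (xs ++ [ r ] ++ ys) + 1 C 2      ∎
        where open ≡-Reasoning

    triangle-extension : ∀ {S T v p q} → Covers S T → p ∈ S → q ∈ S → v ⇒ p → p ⇒ q → q ⇒ v →
                         ColourExtension T S [ v ]
    triangle-extension {T = T} {v} covers p∈ q∈ v⇒p p⇒q q⇒v with non-rainbow v⇒p p⇒q q⇒v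
    ... | inj₁ vp≡pq = one-vertex-extension _ covers p∈ λ _ _ _ →
      ∈-++⁺ˡ (subst (_∈ T) (trans (sym vp≡pq) (sym (edgeColour-out v⇒p))) (covers p∈ q∈ p⇒q))
    ... | inj₂ (inj₁ pq≡qv) = one-vertex-extension _ covers q∈ λ _ _ _ →
      ∈-++⁺ˡ (subst (_∈ T) (trans pq≡qv (sym (edgeColour-in q⇒v))) (covers p∈ q∈ p⇒q))
    ... | inj₂ (inj₂ vp≡qv) = one-vertex-extension _ covers p∈ redundant
      where
      redundant : ∀ xs ys → _ ≡ xs ++ [ _ ] ++ ys →
                  edgeColour v _ ∈ T ++ map (edgeColour v) (xs ++ ys)
      redundant xs ys refl with ∈-insert⁻ xs ys q∈
      ... | inj₁ q≡p = ⊥-elim (⇒-≢ p⇒q (sym q≡p))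
      ... | inj₂ q∈′ = ∈-++⁺ʳ T (subst (_∈ _) same (∈-map⁺ (edgeColour v) q∈′))
        where
        same : edgeColour v _ ≡ edgeColour v _
        same = trans (edgeColour-in q⇒v) (trans (sym vp≡qv) (sym (edgeColour-out v⇒p)))

    shared-colour : ∀ {a s b} → a ⇒ s → s ⇒ b → b ⇒ a →
                    ∃ λ c → edgeColour a s ∈ c ∷ [ col b a ] × edgeColour b s ∈ c ∷ [ col b a ]
    shared-colour a⇒s s⇒b b⇒a rewrite edgeColour-out a⇒s | edgeColour-in s⇒b
      with non-rainbow a⇒s s⇒b b⇒a
    ... | inj₁ as≡sb = _ , here refl , here (sym as≡sb)
    ... | inj₂ (inj₁ sb≡ba) = _ , here refl , there (here sb≡ba)
    ... | inj₂ (inj₂ as≡ba) = _ , there (here as≡ba) , here refl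

    pair-extension : ∀ {S T a b} → 2 ≤ length S → Covers S T →
                     All (_⇒ b) S → All (a ⇒_) S → b ⇒ a → ColourExtension T S (a ∷ [ b ])
    pair-extension {_ ∷ []} (s≤s ()) _ _ _ _
    pair-extension {s₁ ∷ s₂ ∷ rest} {T} {a} {b} _ covers S⇒b a⇒S b⇒a =
      E , Covers-∷ (Covers-∷ (Covers-mono ∈-++⁺ˡ covers) from-b) from-a , ≤-reflexive count
      where
      S = s₁ ∷ s₂ ∷ rest
      shared : ∀ {s} → s ∈ S →
               ∃ λ c → edgeColour a s ∈ c ∷ [ col b a ] × edgeColour b s ∈ c ∷ [ col b a ]
      shared s∈ = shared-colour (All.lookup a⇒S s∈) (All.lookup S⇒b s∈) b⇒a
      shared₁ = shared (here refl)
      shared₂ = shared (there (here refl))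
      E : List ℕ
      E = col b a ∷ proj₁ shared₁ ∷ proj₁ shared₂ ∷ map (edgeColour a) rest ++ map (edgeColour b) rest
      via : ∀ {c x} → c ∈ E → x ∈ c ∷ [ col b a ] → x ∈ T ++ E
      via c∈E (here refl) = ∈-++⁺ʳ T c∈E
      via _ (there (here refl)) = ∈-++⁺ʳ T (here refl)
      from-b : ∀ {s} → s ∈ S → edgeColour b s ∈ T ++ E
      from-b (here refl) = via (there (here refl)) (proj₂ (proj₂ shared₁))
      from-b (there (here refl)) = via (there (there (here refl))) (proj₂ (proj₂ shared₂))
      from-b (there (there s∈)) =
        ∈-++⁺ʳ T (there (there (there (∈-++⁺ʳ (map (edgeColour a) rest) (∈-map⁺ (edgeColour b) s∈)))))
      from-a : ∀ {s} → s ∈ b ∷ S → edgeColour a s ∈ T ++ E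
      from-a (here refl) = subst (_∈ T ++ E) (sym (edgeColour-in b⇒a)) (∈-++⁺ʳ T (here refl))
      from-a (there (here refl)) = via (there (here refl)) (proj₁ (proj₂ shared₁))
      from-a (there (there (here refl))) = via (there (there (here refl))) (proj₁ (proj₂ shared₂))
      from-a (there (there (there s∈))) =
        ∈-++⁺ʳ T (there (there (there (∈-++⁺ˡ (∈-map⁺ (edgeColour a) s∈)))))
      count : length E + 2 ≡ 2 * length S + 2 C 2
      count = begin
        3 + length (map (edgeColour a) rest ++ map (edgeColour b) rest) + 2
          ≡⟨ cong (λ m → 3 + m + 2) (length-++ (map (edgeColour a) rest)) ⟩
        3 + (length (map (edgeColour a) rest) + length (map (edgeColour b) rest)) + 2
          ≡⟨ cong₂ (λ x y → 3 + (x + y) + 2) (length-map (edgeColour a) rest) (length-map _ rest) ⟩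
        3 + (length rest + length rest) + 2
          ≡⟨ arithmetic (length rest) ⟩
        2 * length S + 2 C 2 ∎
        where
        open ≡-Reasoning
        arithmetic : ∀ r → 3 + (r + r) + 2 ≡ 2 * (2 + r) + 1
        arithmetic = solve-∀

    record Frugal : Set where
      field
        vertices    : List (Fin n)
        hamiltonian : Cycle vertices
        unique      : Unique vertices
        colours     : List ℕ
        covers      : Covers vertices colours
        budget      : InBudget (length colours) (length vertices)

    first∈ : (F : Frugal) → Cycle.first (Frugal.hamiltonian F) ∈ Frugal.vertices F
    first∈ F = head∈ (Cycle.chain (Frugal.hamiltonian F))

    Growth : Frugal → Set
    Growth F = Σ Frugal λ F′ → length (Frugal.vertices F) < length (Frugal.vertices F′)

    extend : (F : Frugal) (N : List (Fin n)) {v : Fin n} {S′ : List (Fin n)} → let open Frugal F in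
             Cycle S′ → S′ ↭ v ∷ N ++ vertices → Unique (v ∷ N ++ vertices) →
             ColourExtension colours vertices (v ∷ N) → Growth F
    extend F N {v} {S′} hamiltonian′ S′↭ unique′ (E , covers′ , count) =
      record
        { vertices = S′
        ; hamiltonian = hamiltonian′
        ; unique = Unique-resp-↭ (↭-sym S′↭) unique′
        ; colours = colours ++ E
        ; covers = Covers-resp-↭ (↭-sym S′↭) covers′
        ; budget = subst₂ InBudget (sym (length-++ colours)) (sym |S′|)
                          (InBudget-extend {j = length (v ∷ N)} budget count)
        } ,
      ≤-trans (s≤s (m≤n+m _ (length N))) (≤-reflexive (sym |S′|))
      where
      open Frugal F
      |S′| : length S′ ≡ length (v ∷ N) + length vertices
      |S′| = trans (↭-length S′↭) (cong suc (length-++ N))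

    absorb-vertex : (F : Frugal) {v : Fin n} → let open Frugal F in
                    v ∉ vertices → Any (_⇒ v) vertices → Any (v ⇒_) vertices → Growth F
    absorb-vertex F v∉ anyIn anyOut
      with S′ , hamiltonian′ , S′↭ ← insert-cycle (Frugal.hamiltonian F) anyIn anyOut v∉
         | p , q , p∈ , q∈ , v⇒p , p⇒q , q⇒v ← triangle-through (Frugal.hamiltonian F) anyIn anyOut v∉
      = extend F [] hamiltonian′ S′↭ (¬Any⇒All¬ _ v∉ ∷ Frugal.unique F)
               (triangle-extension (Frugal.covers F) p∈ q∈ v⇒p p⇒q q⇒v)

    absorb-pair : (F : Frugal) {a b : Fin n} → let open Frugal F in
                  b ∉ vertices → a ∉ vertices → All (_⇒ b) vertices → All (a ⇒_) vertices → b ⇒ a →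
                  Growth F
    absorb-pair F {b = b} b∉ a∉ S⇒b a⇒S b⇒a =
      extend F [ b ] (cycle (chain ▻ All.lookup S⇒b (last∈ chain) ▻ b⇒a) (All.lookup a⇒S (head∈ chain)))
        (↭-trans (↭-sym (∷↭∷ʳ _ _)) (prep _ (↭-sym (∷↭∷ʳ _ _))))
        ((⇒-≢ b⇒a ∘ sym ∷ ¬Any⇒All¬ _ a∉) ∷ ¬Any⇒All¬ _ b∉ ∷ unique)
        (pair-extension (Cycle-length hamiltonian) covers S⇒b a⇒S b⇒a)
      where
      open Frugal F
      open Cycle hamiltonian

    triangle-colours : ∀ {a b c} → a ⇒ b → b ⇒ c → c ⇒ a →
                       ∃ λ T → length T ≡ 2 × col a b ∈ T × col b c ∈ T × col c a ∈ T
    triangle-colours {a} {b} {c} a⇒b b⇒c c⇒a with non-rainbow a⇒b b⇒c c⇒a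
    ... | inj₁ ab≡bc =
      col b c ∷ [ col c a ] , refl , here ab≡bc , here refl , there (here refl)
    ... | inj₂ (inj₁ bc≡ca) =
      col a b ∷ [ col c a ] , refl , here refl , there (here bc≡ca) , there (here refl)
    ... | inj₂ (inj₂ ab≡ca) =
      col b c ∷ [ col c a ] , refl , there (here ab≡ca) , here refl , there (here refl)

    triangle-frugal : ∀ {a b c} → a ⇒ b → b ⇒ c → c ⇒ a → Frugal
    triangle-frugal {a} {b} {c} a⇒b b⇒c c⇒a
      with T , |T| , ab∈ , bc∈ , ca∈ ← triangle-colours a⇒b b⇒c c⇒a = record
      { vertices = a ∷ b ∷ c ∷ []
      ; hamiltonian = cycle (a⇒b ◅ b⇒c ◅ done c) c⇒a
      ; unique = (⇒-≢ a⇒b ∷ ⇒-≢ c⇒a ∘ sym ∷ []) ∷ (⇒-≢ b⇒c ∷ []) ∷ [] ∷ []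
      ; colours = T
      ; covers = Covers-∷ (Covers-∷ Covers-singleton
                   λ { (here refl) → subst (_∈ T) (sym (edgeColour-out b⇒c)) bc∈ })
                   λ { (here refl) → subst (_∈ T) (sym (edgeColour-out a⇒b)) ab∈
                     ; (there (here refl)) → subst (_∈ T) (sym (edgeColour-in c⇒a)) ca∈ }
      ; budget = subst (λ t → t + 3 ≤ 3 C 2 + 2) (sym |T|) ≤-refl
      }

    numColors≤ : ∀ {S T} → Covers S T → (∀ z → z ∈ S) → numColors D col ≤ length T
    numColors≤ {S} {T} covers spanning =
      Unique⇒length-mono-⊆ (deduplicate-! _≟_ (map colour (arcs D))) used⊆T
      where
      colour : Fin n × Fin n → ℕ
      colour (x , y) = col x y
      pairs : List (Fin n × Fin n)
      pairs = cartesianProduct (allFin n) (allFin n)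
      used⊆T : deduplicate _≟_ (map colour (arcs D)) ⊆ T
      used⊆T c∈ with (x , y) , xy∈ , refl ← ∈-map⁻ colour (∈-deduplicate⁻ _≟_ _ c∈) =
        covers (spanning x) (spanning y) (proj₂ (∈-filter⁻ (λ (x , y) → T? (D x y)) {xs = pairs} xy∈))

    module _ (strong : StronglyConnected D) where

      grow-beyond-dominated : (F : Frugal) {p q : Fin n} → let open Frugal F in
                              All (_⇒ p) vertices → ¬ All (_⇒ q) vertices → p ⇒ q → Growth F
      grow-beyond-dominated F S⇒p ¬S⇒q p⇒q
        with position (Frugal.vertices F) (out-of-dominated-∉ S⇒p p⇒q)
      ... | mixed anyIn anyOut = absorb-vertex F (out-of-dominated-∉ S⇒p p⇒q) anyIn anyOut
      ... | dominates q⇒S = absorb-pair F (dominated-∉ S⇒p) (dominating-∉ q⇒S) S⇒p q⇒S p⇒q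
      ... | dominated S⇒q = ⊥-elim (¬S⇒q S⇒q)

      grow-below-dominating : (F : Frugal) {p q : Fin n} → let open Frugal F in
                              ¬ All (p ⇒_) vertices → All (q ⇒_) vertices → p ⇒ q → Growth F
      grow-below-dominating F ¬p⇒S q⇒S p⇒q
        with position (Frugal.vertices F) (into-dominating-∉ q⇒S p⇒q)
      ... | mixed anyIn anyOut = absorb-vertex F (into-dominating-∉ q⇒S p⇒q) anyIn anyOut
      ... | dominates p⇒S = ⊥-elim (¬p⇒S p⇒S)
      ... | dominated S⇒p = absorb-pair F (dominated-∉ S⇒p) (dominating-∉ q⇒S) S⇒p q⇒S p⇒q

      grow : (F : Frugal) {v : Fin n} → v ∉ Frugal.vertices F → Growth F
      grow F {v} v∉ with position (Frugal.vertices F) v∉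
      ... | mixed anyIn anyOut = absorb-vertex F v∉ anyIn anyOut
      ... | dominated S⇒v
        with _ , path ← chain-between strong (∉⇒≢ v∉ (first∈ F))
        with p , q , _ , _ , p⇒q , S⇒p , ¬S⇒q ←
               crossing-to-last (λ z → all? (_⇒? z) (Frugal.vertices F)) path
                 (lose (head∈ path) S⇒v) (λ S⇒h → dominated-∉ S⇒h (first∈ F))
        = grow-beyond-dominated F S⇒p ¬S⇒q p⇒q
      ... | dominates v⇒S
        with _ , path ← chain-between strong (∉⇒≢ v∉ (first∈ F) ∘ sym)
        with p , q , _ , _ , p⇒q , ¬p⇒S , ¬¬q⇒S ←
               crossing-to-last (λ z → ¬? (all? (z ⇒?_) (Frugal.vertices F))) path
                 (lose (head∈ path) (λ h⇒S → dominating-∉ h⇒S (first∈ F))) (λ ¬v⇒S → ¬v⇒S v⇒S)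
        = grow-below-dominating F ¬p⇒S (decidable-stable (all? (q ⇒?_) _) ¬¬q⇒S) p⇒q

      saturate : (fuel : ℕ) (F : Frugal) → n ≤ length (Frugal.vertices F) + fuel →
                 Σ Frugal λ F → ∀ z → z ∈ Frugal.vertices F
      saturate fuel F n≤ with Fin.all? (λ z → z ∈? Frugal.vertices F)
      ... | yes spanning = F , spanning
      ... | no ¬spanning
        with z , z∉ ← Fin.¬∀⟶∃¬ n _ (λ z → z ∈? Frugal.vertices F) ¬spanning
        with fuel
      ... | zero = ⊥-elim (n≮n _ (≤-trans (Unique⇒length≤ (¬Any⇒All¬ _ z∉ ∷ Frugal.unique F))
                                          (≤-trans n≤ (≤-reflexive (+-identityʳ _)))))
      ... | suc fuel′ with F′ , grown ← grow F z∉ =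
        saturate fuel′ F′ (≤-trans n≤ (≤-trans (≤-reflexive (+-suc _ fuel′)) (+-monoˡ-≤ fuel′ grown)))

      colour-budget : ∀ {x y} → x ⇒ y → InBudget (numColors D col) n
      colour-budget x⇒y
        with p , q , x⇒p , p⇒q , q⇒x ← directed-triangle strong x⇒y
        with F , spanning ← saturate n (triangle-frugal x⇒p p⇒q q⇒x) (m≤n+m n _)
        = subst (InBudget (numColors D col)) (Unique∧spanning⇒length≡ unique spanning)
                (≤-trans (+-monoˡ-≤ (length vertices) (numColors≤ covers spanning)) budget)
        where open Frugal F

rainbow-triangle? : ∀ {n} (D : Digraph n) (col : ArcColoring n) → Dec (RainbowTriangle D col)
rainbow-triangle? D col = Fin.any? λ x → Fin.any? λ y → Fin.any? λ z →
  T? (D x y) ×-dec T? (D y z) ×-dec T? (D z x) ×-dec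
  ¬? (col x y ≟ col y z) ×-dec ¬? (col y z ≟ col z x) ×-dec ¬? (col x y ≟ col z x)

numColors≤pairs : ∀ {n} (D : Digraph n) (col : ArcColoring n) →
                  numColors D col ≤ length (cartesianProduct (allFin n) (allFin n))
numColors≤pairs {n} D col = ≤-trans (length-deduplicate _≟_ (map colour (arcs D)))
  (≤-trans (≤-reflexive (length-map colour (arcs D)))
           (length-filter (λ (x , y) → T? (D x y)) (cartesianProduct (allFin n) (allFin n))))
  where
  colour : Fin n × Fin n → ℕ
  colour (x , y) = col x y

rainbow-free⇒InBudget : ∀ n (D : Digraph n) (col : ArcColoring n) →
                        IsTournament D → StronglyConnected D → ¬ RainbowTriangle D col →
                        InBudget (numColors D col) n
rainbow-free⇒InBudget zero D col _ _ _ = +-monoˡ-≤ 0 (≤-trans (numColors≤pairs D col) z≤n)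
rainbow-free⇒InBudget (suc zero) D col _ _ _ = +-monoˡ-≤ 1 (numColors≤pairs D col)
rainbow-free⇒InBudget (suc (suc _)) D col tournament strong rainbow-free =
  [ colour-budget strong , colour-budget strong ]′ (proj₁ (proj₂ tournament zero (suc zero) (λ ())))
  where open Tournament D tournament; open Colouring col rainbow-free

theorem4 : (n : ℕ) (D : Digraph n) (col : ArcColoring n) →
    IsTournament D → StronglyConnected D →
    (n C 2) + 3 ≤ numColors D col + n →
    RainbowTriangle D col
theorem4 n D col tournament strong enough with rainbow-triangle? D col
... | yes rainbow = rainbow
... | no rainbow-free = ⊥-elim (over-budget {numColors D col} {n} enough
                                  (rainbow-free⇒InBudget n D col tournament strong rainbow-free))
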